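{- For all integers $m,n\ge 3$ and $p,q\ge 1$ and every positive integer $k$: if $\chi_i(C_m\Box C_n)\le k$ then $\chi_i(C_{pm}\Box C_{qn})\le k$.
   Context: For a graph $G$, an incidence is a pair $(v,e)$ with $v\in V(G)$, $e\in E(G)$ and $v$ incident with $e$. Two incidences $(v,e)$ and $(w,f)$ are adjacent if $v=w$, or $e=f$, or the edge $vw$ equals $e$ or $f$. An incidence $k$-coloring of $G$ is a map from the set of incidences of $G$ to a set of $k$ colors such that adjacent incidences receive distinct colors; $\chi_i(G)$ is the least $k$ for which such a coloring exists. $C_n$ is the cycle on $n$ vertices and $\Box$ denotes the Cartesian product of graphs. -}

module Defs where

open import Data.Nat using (ℕ; suc; _+_; _%_; NonZero)
open import Data.Fin using (Fin; toℕ)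
open import Data.Product using (Σ; _×_; ∃; _,_)
open import Data.Sum using (_⊎_)
open import Relation.Binary.PropositionalEquality using (_≡_; _≢_)
open import Relation.Nullary using (¬_)

record Graph : Set₁ where
  field
    V   : Set
    Adj : V → V → Set

open Graph public

SameEdge : {V : Set} → V → V → V → V → Set
SameEdge a b c d = (a ≡ c × b ≡ d) ⊎ (a ≡ d × b ≡ c)

-- An incidence (v, e) with v ∈ e: in a simple graph e = vw for the unique
-- other endpoint w, so an incidence is recorded as (v , w , proof that vw ∈ E).
Incidence : Graph → Set
Incidence G = Σ (V G) λ v → Σ (V G) λ w → Adj G v w

inc-v : {G : Graph} → Incidence G → V G
inc-v (v , _ , _) = v

inc-w : {G : Graph} → Incidence G → V G
inc-w (_ , w , _) = w

SameIncidence : {G : Graph} → Incidence G → Incidence G → Set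
SameIncidence (v , w , _) (v' , w' , _) = v ≡ v' × w ≡ w'

IncAdjacent : (G : Graph) → Incidence G → Incidence G → Set
IncAdjacent G (v , w , _) (v' , w' , _) =
  v ≡ v' ⊎ SameEdge v w v' w' ⊎
  (Adj G v v' × (SameEdge v v' v w ⊎ SameEdge v v' v' w'))

IsIncidenceColoring : (G : Graph) (k : ℕ) → (Incidence G → Fin k) → Set
IsIncidenceColoring G k c =
  (ι ι' : Incidence G) → ¬ SameIncidence {G} ι ι' → IncAdjacent G ι ι' → c ι ≢ c ι'

-- χ_i(G) ≤ k  iff  G admits an incidence k-coloring
-- (χ_i is the least k admitting one, and colorings with fewer colors are k-colorings).
χi≤ : Graph → ℕ → Set
χi≤ G k = ∃ λ (c : Incidence G → Fin k) → IsIncidenceColoring G k c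

Cycle : (m : ℕ) → .{{NonZero m}} → Graph
Cycle m = record
  { V   = Fin m
  ; Adj = λ i j → ((toℕ i + 1) % m ≡ toℕ j) ⊎ ((toℕ j + 1) % m ≡ toℕ i)
  }

_□_ : Graph → Graph → Graph
G □ H = record
  { V   = V G × V H
  ; Adj = λ { (a , b) (c , d) → (a ≡ c × Adj H b d) ⊎ (Adj G a c × b ≡ d) }
  }

-- A residue map C_N → C_m with m ∣ N is a graph homomorphism that is injective on every
-- neighbourhood as soon as m ≥ 3, and so is its product C_{pm} □ C_{qn} → C_m □ C_n.
-- Such a map sends distinct adjacent incidences to distinct adjacent incidences of a
-- loopless graph, so composing an incidence colouring of C_m □ C_n with it colours
-- C_{pm} □ C_{qn} with the same colours.
module Submission where

open import Defs
open import Data.Nat using (ℕ; _*_; _+_; _≤_; _<_; z<s; NonZero; >-nonZero; _%_; _/_; _∸_)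
open import Data.Nat.Properties
open import Data.Nat.DivMod using (m≡m%n+[m/n]*n; %-distribˡ-+; m%n%n≡m%n; m%n<n; m<n⇒m%n≡m; m∣n⇒o%n%m≡o%m)
open import Data.Nat.Divisibility using (_∣_; divides; ∣⇒≤; n∣m*n)
open import Data.Fin using (Fin; toℕ; fromℕ<)
open import Data.Fin.Properties using (toℕ-injective; toℕ-fromℕ<; toℕ<n)
open import Data.Product using (_,_; proj₁; proj₂)
open import Data.Sum using (inj₁; inj₂)
open import Data.Empty using (⊥-elim)
open import Relation.Binary using (tri<; tri≈; tri>)
open import Relation.Binary.PropositionalEquality
open import Relation.Nullary using (¬_)

Loopless : Graph → Set
Loopless G = ∀ {x} → ¬ Adj G x x

record LocallyInjectiveHom (G H : Graph) : Set where
  field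
    map       : V G → V H
    map-adj   : ∀ {x y} → Adj G x y → Adj H (map x) (map y)
    injective-on-neighbours :
      ∀ {v w w'} → Adj G v w → Adj G v w' → map w ≡ map w' → w ≡ w'

module _ {G H : Graph} (φ : LocallyInjectiveHom G H) where
  open LocallyInjectiveHom φ

  adjacent-images-differ : Loopless H → ∀ {x y} → Adj G x y → map x ≢ map y
  adjacent-images-differ loopless {x} xy fx≡fy =
    loopless (subst (Adj H (map x)) (sym fx≡fy) (map-adj xy))

  mapIncidence : Incidence G → Incidence H
  mapIncidence (v , w , vw) = map v , map w , map-adj vw

  mapSameEdge : ∀ {a b c d} → SameEdge a b c d → SameEdge (map a) (map b) (map c) (map d)
  mapSameEdge (inj₁ (a≡c , b≡d)) = inj₁ (cong map a≡c , cong map b≡d)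
  mapSameEdge (inj₂ (a≡d , b≡c)) = inj₂ (cong map a≡d , cong map b≡c)

  mapIncidence-adjacent : ∀ ι ι' → IncAdjacent G ι ι' → IncAdjacent H (mapIncidence ι) (mapIncidence ι')
  mapIncidence-adjacent _ _ (inj₁ v≡v')                  = inj₁ (cong map v≡v')
  mapIncidence-adjacent _ _ (inj₂ (inj₁ e≡f))            = inj₂ (inj₁ (mapSameEdge e≡f))
  mapIncidence-adjacent _ _ (inj₂ (inj₂ (vv' , inj₁ s))) = inj₂ (inj₂ (map-adj vv' , inj₁ (mapSameEdge s)))
  mapIncidence-adjacent _ _ (inj₂ (inj₂ (vv' , inj₂ s))) = inj₂ (inj₂ (map-adj vv' , inj₂ (mapSameEdge s)))

  mapIncidence-distinct : Loopless H → ∀ ι ι' → ¬ SameIncidence {G} ι ι' → IncAdjacent G ι ι' →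
                          ¬ SameIncidence {H} (mapIncidence ι) (mapIncidence ι')
  mapIncidence-distinct _ (v , w , vw) (.v , w' , vw') ι≠ι' (inj₁ refl) (_ , fw≡fw') =
    ι≠ι' (refl , injective-on-neighbours vw vw' fw≡fw')
  mapIncidence-distinct _ _ _ ι≠ι' (inj₂ (inj₁ (inj₁ same))) _ = ι≠ι' same
  mapIncidence-distinct loopless (_ , _ , vw) _ _ (inj₂ (inj₁ (inj₂ (_ , w≡v')))) (fv≡fv' , _) =
    adjacent-images-differ loopless vw (trans fv≡fv' (sym (cong map w≡v')))
  mapIncidence-distinct loopless _ _ _ (inj₂ (inj₂ (vv' , _))) (fv≡fv' , _) =
    adjacent-images-differ loopless vv' fv≡fv'

  χi≤-pullback : Loopless H → ∀ {k} → χi≤ H k → χi≤ G k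
  χi≤-pullback loopless (c , proper) =
    (λ ι → c (mapIncidence ι)) ,
    λ ι ι' ι≠ι' adj → proper _ _ (mapIncidence-distinct loopless ι ι' ι≠ι' adj)
                                 (mapIncidence-adjacent ι ι' adj)

□-loopless : ∀ {G H} → Loopless G → Loopless H → Loopless (G □ H)
□-loopless _        looplessH (inj₁ (_ , bb)) = looplessH bb
□-loopless looplessG _        (inj₂ (aa , _)) = looplessG aa

-- Looplessness of G' rules out a first-coordinate neighbour and a second-coordinate
-- neighbour of the same vertex having equal images.
□-hom : ∀ {G G' H H'} → Loopless G' → LocallyInjectiveHom G G' → LocallyInjectiveHom H H' →
        LocallyInjectiveHom (G □ H) (G' □ H')
□-hom {G} {G'} {H} {H'} looplessG' φ ψ = record
  { map = λ { (a , b) → φ.map a , ψ.map b }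
  ; map-adj = λ { (inj₁ (refl , bb')) → inj₁ (refl , ψ.map-adj bb')
                ; (inj₂ (aa' , refl)) → inj₂ (φ.map-adj aa' , refl) }
  ; injective-on-neighbours = injective
  }
  where
  module φ = LocallyInjectiveHom φ
  module ψ = LocallyInjectiveHom ψ

  injective : ∀ {v w w'} → Adj (G □ H) v w → Adj (G □ H) v w' →
              (φ.map (proj₁ w) , ψ.map (proj₂ w)) ≡ (φ.map (proj₁ w') , ψ.map (proj₂ w')) → w ≡ w'
  injective (inj₁ (refl , bb₁)) (inj₁ (refl , bb₂)) eq =
    cong (_ ,_) (ψ.injective-on-neighbours bb₁ bb₂ (cong proj₂ eq))
  injective (inj₂ (aa₁ , refl)) (inj₂ (aa₂ , refl)) eq =
    cong (_, _) (φ.injective-on-neighbours aa₁ aa₂ (cong proj₁ eq))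
  injective (inj₁ (refl , _)) (inj₂ (aa' , refl)) eq =
    ⊥-elim (adjacent-images-differ φ looplessG' aa' (cong proj₁ eq))
  injective (inj₂ (aa' , refl)) (inj₁ (refl , _)) eq =
    ⊥-elim (adjacent-images-differ φ looplessG' aa' (sym (cong proj₁ eq)))

[m%n+o]%n≡[m+o]%n : ∀ m o n .{{_ : NonZero n}} → (m % n + o) % n ≡ (m + o) % n
[m%n+o]%n≡[m+o]%n m o n = begin
  (m % n + o) % n          ≡⟨ %-distribˡ-+ (m % n) o n ⟩
  (m % n % n + o % n) % n  ≡⟨ cong (λ r → (r + o % n) % n) (m%n%n≡m%n m n) ⟩
  (m % n + o % n) % n      ≡⟨ %-distribˡ-+ m o n ⟨
  (m + o) % n              ∎
  where open ≡-Reasoning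

[m+d]%n≡m%n⇒n∣d : ∀ m d n .{{_ : NonZero n}} → (m + d) % n ≡ m % n → n ∣ d
[m+d]%n≡m%n⇒n∣d m d n eq = divides ((r + d) / n) (+-cancelˡ-≡ r d _ r+d≡r+[r+d]/n*n)
  where
  open ≡-Reasoning
  r = m % n
  r+d≡r+[r+d]/n*n : r + d ≡ r + (r + d) / n * n
  r+d≡r+[r+d]/n*n = begin
    r + d                         ≡⟨ m≡m%n+[m/n]*n (r + d) n ⟩
    (r + d) % n + (r + d) / n * n ≡⟨ cong (_+ (r + d) / n * n) (trans ([m%n+o]%n≡[m+o]%n m d n) eq) ⟩
    r + (r + d) / n * n           ∎

[m+d]%n≢m%n : ∀ m d n .{{_ : NonZero n}} → 0 < d → d < n → (m + d) % n ≢ m % n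
[m+d]%n≢m%n m d n 0<d d<n eq =
  <⇒≱ d<n (∣⇒≤ {{>-nonZero 0<d}} ([m+d]%n≡m%n⇒n∣d m d n eq))

<⇒[x+o]%n≢[y+o]%n : ∀ {x y} o n .{{_ : NonZero n}} → x < y → y < n → (x + o) % n ≢ (y + o) % n
<⇒[x+o]%n≢[y+o]%n {x} {y} o n x<y y<n eq =
  [m+d]%n≢m%n (x + o) (y ∸ x) n (m<n⇒0<n∸m x<y) (≤-<-trans (m∸n≤m y x) y<n)
    (trans (cong (_% n) x+o+[y∸x]≡y+o) (sym eq))
  where
  x+o+[y∸x]≡y+o : x + o + (y ∸ x) ≡ y + o
  x+o+[y∸x]≡y+o = begin
    x + o + (y ∸ x)   ≡⟨ +-assoc x o (y ∸ x) ⟩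
    x + (o + (y ∸ x)) ≡⟨ cong (x +_) (+-comm o (y ∸ x)) ⟩
    x + ((y ∸ x) + o) ≡⟨ +-assoc x (y ∸ x) o ⟨
    x + (y ∸ x) + o   ≡⟨ cong (_+ o) (m+[n∸m]≡n (<⇒≤ x<y)) ⟩
    y + o             ∎
    where open ≡-Reasoning

[m+1]%n-injective : ∀ {x y n} .{{_ : NonZero n}} → x < n → y < n →
                    (x + 1) % n ≡ (y + 1) % n → x ≡ y
[m+1]%n-injective {x} {y} {n} x<n y<n eq with <-cmp x y
... | tri< x<y _ _ = ⊥-elim (<⇒[x+o]%n≢[y+o]%n 1 n x<y y<n eq)
... | tri≈ _ x≡y _ = x≡y
... | tri> _ _ y<x = ⊥-elim (<⇒[x+o]%n≢[y+o]%n 1 n y<x x<n (sym eq))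

successor-irreflexive : ∀ m .{{_ : NonZero m}} → 2 ≤ m → (i : Fin m) → (toℕ i + 1) % m ≢ toℕ i
successor-irreflexive m 2≤m i i+1≡i =
  [m+d]%n≢m%n (toℕ i) 1 m z<s 2≤m (trans i+1≡i (sym (m<n⇒m%n≡m (toℕ<n i))))

Cycle-loopless : ∀ m .{{_ : NonZero m}} → 2 ≤ m → Loopless (Cycle m)
Cycle-loopless m 2≤m {i} (inj₁ i+1≡i) = successor-irreflexive m 2≤m i i+1≡i
Cycle-loopless m 2≤m {i} (inj₂ i+1≡i) = successor-irreflexive m 2≤m i i+1≡i

module _ {N m : ℕ} .{{_ : NonZero N}} .{{_ : NonZero m}} (m∣N : m ∣ N) where

  reduce : Fin N → Fin m
  reduce i = fromℕ< (m%n<n (toℕ i) m)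

  toℕ-reduce : ∀ i → toℕ (reduce i) ≡ toℕ i % m
  toℕ-reduce i = toℕ-fromℕ< (m%n<n (toℕ i) m)

  reduce-cong : ∀ {x y} → x % N ≡ y → x % m ≡ y % m
  reduce-cong {x} x%N≡y = trans (sym (m∣n⇒o%n%m≡o%m m N x m∣N)) (cong (_% m) x%N≡y)

  reduce-successor : ∀ {i j : Fin N} → (toℕ i + 1) % N ≡ toℕ j →
                     (toℕ (reduce i) + 1) % m ≡ toℕ (reduce j)
  reduce-successor {i} {j} i+1≡j = begin
    (toℕ (reduce i) + 1) % m ≡⟨ cong (λ r → (r + 1) % m) (toℕ-reduce i) ⟩
    (toℕ i % m + 1) % m      ≡⟨ [m%n+o]%n≡[m+o]%n (toℕ i) 1 m ⟩
    (toℕ i + 1) % m          ≡⟨ reduce-cong i+1≡j ⟩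
    toℕ j % m                ≡⟨ toℕ-reduce j ⟨
    toℕ (reduce j)           ∎
    where open ≡-Reasoning

  -- A successor j and a predecessor j' of the same vertex differ by 2, which m ≥ 3 detects.
  successor-predecessor-reduce-differ : 3 ≤ m → ∀ {i j j' : Fin N} →
    (toℕ i + 1) % N ≡ toℕ j → (toℕ j' + 1) % N ≡ toℕ i → reduce j ≢ reduce j'
  successor-predecessor-reduce-differ 3≤m {i} {j} {j'} i+1≡j j'+1≡i rj≡rj' =
    [m+d]%n≢m%n (toℕ j') 2 m z<s 3≤m (begin
      (toℕ j' + 2) % m            ≡⟨ cong (_% m) (+-assoc (toℕ j') 1 1) ⟨
      (toℕ j' + 1 + 1) % m        ≡⟨ [m%n+o]%n≡[m+o]%n (toℕ j' + 1) 1 m ⟨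
      ((toℕ j' + 1) % m + 1) % m  ≡⟨ cong (λ r → (r + 1) % m) (reduce-cong j'+1≡i) ⟩
      (toℕ i % m + 1) % m         ≡⟨ [m%n+o]%n≡[m+o]%n (toℕ i) 1 m ⟩
      (toℕ i + 1) % m             ≡⟨ reduce-cong i+1≡j ⟩
      toℕ j % m                   ≡⟨ trans (sym (toℕ-reduce j)) (trans (cong toℕ rj≡rj') (toℕ-reduce j')) ⟩
      toℕ j' % m                  ∎)
    where open ≡-Reasoning

  reduce-hom : 3 ≤ m → LocallyInjectiveHom (Cycle N) (Cycle m)
  reduce-hom 3≤m = record
    { map = reduce
    ; map-adj = λ { (inj₁ i+1≡j) → inj₁ (reduce-successor i+1≡j)
                  ; (inj₂ j+1≡i) → inj₂ (reduce-successor j+1≡i) }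
    ; injective-on-neighbours = injective
    }
    where
    injective : ∀ {i j j'} → Adj (Cycle N) i j → Adj (Cycle N) i j' → reduce j ≡ reduce j' → j ≡ j'
    injective (inj₁ i+1≡j) (inj₁ i+1≡j') _ = toℕ-injective (trans (sym i+1≡j) i+1≡j')
    injective {_} {j} {j'} (inj₂ j+1≡i) (inj₂ j'+1≡i) _ =
      toℕ-injective ([m+1]%n-injective (toℕ<n j) (toℕ<n j') (trans j+1≡i (sym j'+1≡i)))
    injective (inj₁ i+1≡j) (inj₂ j'+1≡i) rj≡rj' =
      ⊥-elim (successor-predecessor-reduce-differ 3≤m i+1≡j j'+1≡i rj≡rj')
    injective (inj₂ j+1≡i) (inj₁ i+1≡j') rj≡rj' =
      ⊥-elim (successor-predecessor-reduce-differ 3≤m i+1≡j' j+1≡i (sym rj≡rj'))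

mainTheorem5 : (m n p q k : ℕ) → 3 ≤ m → 3 ≤ n → 1 ≤ p → 1 ≤ q → 1 ≤ k →
    .{{_ : NonZero m}} → .{{_ : NonZero n}} →
    .{{_ : NonZero (p * m)}} → .{{_ : NonZero (q * n)}} →
    χi≤ (Cycle m □ Cycle n) k → χi≤ (Cycle (p * m) □ Cycle (q * n)) k
mainTheorem5 m n p q k 3≤m 3≤n _ _ _ =
  χi≤-pullback (□-hom C-m-loopless (reduce-hom (n∣m*n p) 3≤m) (reduce-hom (n∣m*n q) 3≤n))
               (□-loopless {Cycle m} {Cycle n} C-m-loopless (Cycle-loopless n (2≤ 3≤n)))
  where
  2≤ : ∀ {r} → 3 ≤ r → 2 ≤ r
  2≤ = ≤-trans (n≤1+n 2)

  C-m-loopless : Loopless (Cycle m)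
  C-m-loopless = Cycle-loopless m (2≤ 3≤m)
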